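{- Let $G_n$ be the graph defined below and $t\geq 1$ a fixed integer. Then there is a constant $c=c(t)>0$ with $\chi(G_n^t)\geq c\,n^{6t}$ for all $n$, i.e. $\chi(G_n^t)=\Omega(n^{6t})$.
   Context: Let $Q_k=\{0,1\}^k$, $0^k$, $1^k$ the all-zero and all-one vectors, $Q_k^-=Q_k\setminus\{0^k,1^k\}$, and $X\times Y$ the set of concatenations. Let $S = Q_7 \setminus \big[(1^4\times Q_3^-) \cup \{0^4\times 0^3\}\cup\{0^4\times 1^3\}\big]$. $G_n$ has vertex set $[n]^7$, and $x,y$ are adjacent iff $\rho(x,y)\in S$, where $\rho_i(x,y)=1$ if $x_i\neq y_i$ and $0$ otherwise. The OR product of graphs $G$ and $H$ has vertex set $V(G)\times V(H)$, with $(g,h)\sim(g',h')$ iff $g\sim g'$ in $G$ or $h\sim h'$ in $H$; $G^t$ denotes the OR product of $t$ copies of $G$. $\chi$ is the chromatic number. -}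

module Defs where

open import Data.Nat using (ℕ)
open import Data.Fin using (Fin; _↑ˡ_; _↑ʳ_)
open import Data.Fin.Properties using (_≟_)
open import Data.Bool using (Bool; true; false)
open import Data.Product using (_×_; ∃)
open import Relation.Nullary using (¬_; does)
open import Relation.Binary.PropositionalEquality using (_≡_; _≢_)
open import Level using (0ℓ)

record Graph : Set₁ where
  field
    V   : Set
    Adj : V → V → Set
open Graph public

-- Q_k = {0,1}^k as functions Fin k → Bool (true = 1, false = 0).
Q : ℕ → Set
Q k = Fin k → Bool

All0 : ∀ {k} → Q k → Set
All0 w = ∀ i → w i ≡ false

All1 : ∀ {k} → Q k → Set
All1 w = ∀ i → w i ≡ true

InQ⁻ : ∀ {k} → Q k → Set
InQ⁻ w = ¬ All0 w × ¬ All1 w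

pre4 : Q 7 → Q 4
pre4 w i = w (i ↑ˡ 3)

suf3 : Q 7 → Q 3
suf3 w i = w (4 ↑ʳ i)

-- S = Q_7 \ [ (1^4 × Q_3^-) ∪ {0^4 0^3} ∪ {0^4 1^3} ]
InS : Q 7 → Set
InS w = ¬ (All1 (pre4 w) × InQ⁻ (suf3 w))
      × ¬ (All0 (pre4 w) × All0 (suf3 w))
      × ¬ (All0 (pre4 w) × All1 (suf3 w))

ρ : ∀ {n} → (Fin 7 → Fin n) → (Fin 7 → Fin n) → Q 7
ρ x y i with does (x i ≟ y i)
... | true  = false
... | false = true

G : ℕ → Graph
G n = record { V = Fin 7 → Fin n ; Adj = λ x y → InS (ρ x y) }

ORPower : ℕ → Graph → Graph
ORPower t H = record
  { V   = Fin t → V H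
  ; Adj = λ x y → ∃ λ (i : Fin t) → Adj H (x i) (y i) }

ProperColoring : (H : Graph) (m : ℕ) → (V H → Fin m) → Set
ProperColoring H m f = ∀ x y → Adj H x y → f x ≢ f y

-- χ(H) ≥ k  (unfolded: every proper colouring uses at least k colours)
-- is expressed in the statement by quantifying over all proper colourings.

-- An independent set of G_n has at most 3n vertices. Two of its members that agree in
-- coordinate 0 agree on the whole first block, and their last blocks then agree everywhere
-- or nowhere; two members that differ in coordinate 0 agree somewhere on the last block.
-- Hence coordinate 0, together with a last-block coordinate where a member meets a fixed
-- member with a different coordinate 0 (or just the first last-block coordinate, if there
-- is no such member), labels the set injectively by [n] × [3]. A colour class of G_n^t
-- lies in a product of t independent sets of G_n, so it has at most (3n)^t elements, and
-- χ(G_n^t) ≥ n^(7t) / (3n)^t = n^(6t) / 3^t.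
-- Whether an independent set meets two values of coordinate 0 is only decided under a
-- double negation, which suffices because the conclusion is a decidable inequality.
module Submission where

open import Defs
open import Data.Nat using (ℕ; _≤_; _*_; _^_)
open import Data.Fin using (Fin)
open import Data.Product using (Σ; _×_)

open import Level using (0ℓ)
open import Data.Nat using (zero; suc; _+_; z≤n; _≤?_)
open import Data.Nat.Properties using (*-comm; *-cancelˡ-≤; m^n≢0; m^n>0; ^-*-assoc; ^-distribˡ-+-*)
open import Data.Nat.Solver using (module +-*-Solver)
open import Data.Fin using (zero; suc; _↑ˡ_; _↑ʳ_; splitAt; combine; finToFun; funToFin)
open import Data.Fin.Properties
  using (_≟_; any?; all?; join-splitAt; combine-injective; funToFin-finToFin; finToFun-funToFin; injective⇒≤)
open import Data.Bool using (true; false)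
open import Data.Bool.Properties using () renaming (_≟_ to _≟ᵇ_)
open import Data.Product using (_,_; ∃; proj₁; proj₂)
open import Data.Sum using (_⊎_; inj₁; inj₂)
open import Function using (_∘_)
open import Relation.Nullary using (¬_; Dec; yes; no; contradiction)
open import Relation.Nullary.Decidable using (decidable-stable; ¬¬-excluded-middle)
open import Relation.Nullary.Negation using (¬¬-map)
open import Relation.Unary using (Pred; _⊆_)
open import Relation.Binary.PropositionalEquality

¬¬-pull-Fin : ∀ {k} {B : Fin k → Set} → (∀ i → ¬ ¬ B i) → ¬ ¬ (∀ i → B i)
¬¬-pull-Fin {zero}  _   ¬all = ¬all λ ()
¬¬-pull-Fin {suc k} ¬¬B ¬all =
  ¬¬B zero λ b₀ → ¬¬-pull-Fin (¬¬B ∘ suc) λ bₛ → ¬all λ { zero → b₀ ; (suc i) → bₛ i }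

funToFin-cong : ∀ {a b} {g h : Fin a → Fin b} → g ≗ h → funToFin g ≡ funToFin h
funToFin-cong {zero}  _   = refl
funToFin-cong {suc a} g≗h = cong₂ combine (g≗h zero) (funToFin-cong (g≗h ∘ suc))

funToFin-injective : ∀ {a b} {g h : Fin a → Fin b} → funToFin g ≡ funToFin h → g ≗ h
funToFin-injective {g = g} {h} eq i = begin
  g i                       ≡⟨ finToFun-funToFin g i ⟨
  finToFun (funToFin g) i   ≡⟨ cong (λ w → finToFun w i) eq ⟩
  finToFun (funToFin h) i   ≡⟨ finToFun-funToFin h i ⟩
  h i                       ∎
  where open ≡-Reasoning

finToFun-injective : ∀ {a b} {w w′ : Fin (a ^ b)} → finToFun {a} {b} w ≗ finToFun w′ → w ≡ w′
finToFun-injective {a} {b} {w} {w′} eq = begin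
  w                               ≡⟨ funToFin-finToFin {b} {a} w ⟨
  funToFin (finToFun {a} {b} w)   ≡⟨ funToFin-cong eq ⟩
  funToFin (finToFun {a} {b} w′)  ≡⟨ funToFin-finToFin {b} {a} w′ ⟩
  w′                              ∎
  where open ≡-Reasoning

InjectiveOn : {A B : Set} → (A → A → Set) → Pred A 0ℓ → (A → B) → Set
InjectiveOn _≈_ P g = ∀ {x y} → P x → P y → g x ≡ g y → x ≈ y

AtMost : ℕ → ∀ {N} → Pred (Fin N) 0ℓ → Set
AtMost k {N} P = Σ (Fin N → Fin k) (InjectiveOn _≡_ P)

module _ {N k : ℕ} where

  AtMost-⊆ : {P Q : Pred (Fin N) 0ℓ} → P ⊆ Q → AtMost k Q → AtMost k P
  AtMost-⊆ P⊆Q (label , injective) = label , λ Px Py → injective (P⊆Q Px) (P⊆Q Py)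

  partition-bound : ∀ {m} (colour : Fin N → Fin m) →
                    (∀ c → AtMost k (λ w → colour w ≡ c)) → N ≤ m * k
  partition-bound {m} colour small = injective⇒≤ label-injective
    where
    label : Fin N → Fin (m * k)
    label w = combine (colour w) (proj₁ (small (colour w)) w)

    label-injective : ∀ {w w′} → label w ≡ label w′ → w ≡ w′
    label-injective {w} {w′} eq with combine-injective (colour w) _ (colour w′) _ eq
    ... | same-colour , same-label =
      proj₂ (small (colour w)) refl (sym same-colour)
        (trans same-label (cong (λ c → proj₁ (small c) w′) (sym same-colour)))

AtMost-Π : ∀ {t k N} {P : Fin t → Pred (Fin N) 0ℓ} →
           (∀ i → AtMost k (P i)) → AtMost (k ^ t) (λ w → ∀ i → P i (finToFun {N} {t} w i))
AtMost-Π {t} {N = N} small =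
  (λ w → funToFin λ i → proj₁ (small i) (finToFun w i)) ,
  λ Pw Pw′ eq → finToFun-injective {N} {t} λ i →
                  proj₂ (small i) (Pw i) (Pw′ i) (funToFin-injective eq i)

AtMost-finToFun : ∀ {a b k} {P : Pred (Fin b → Fin a) 0ℓ} (label : (Fin b → Fin a) → Fin k) →
                  InjectiveOn _≗_ P label → AtMost k (P ∘ finToFun {a} {b})
AtMost-finToFun {a} {b} label injective =
  label ∘ finToFun , λ Pw Pw′ eq → finToFun-injective {a} {b} (injective Pw Pw′ eq)

Independent : (H : Graph) → Pred (V H) 0ℓ → Set
Independent H P = ∀ {u v} → P u → P v → ¬ Adj H u v

module _ (H : Graph) {N k : ℕ} (decode : Fin N → V H)
         (independent-small : ∀ {P} → Independent H P → ¬ ¬ AtMost k (P ∘ decode)) where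

  orPower-colouring-bound : ∀ t m (f : V (ORPower t H) → Fin m) →
                            ProperColoring (ORPower t H) m f → N ^ t ≤ m * k ^ t
  orPower-colouring-bound t m f proper =
    decidable-stable (N ^ t ≤? m * k ^ t)
      (¬¬-map (λ small → partition-bound colour λ c → AtMost-⊆ (class⊆box c) (AtMost-Π (small c)))
        (¬¬-pull-Fin λ c → ¬¬-pull-Fin λ i → independent-small (projection-independent c i)))
    where
    Projection : Fin m → Fin t → Pred (V H) 0ℓ
    Projection c i u = ∃ λ x → f x ≡ c × x i ≡ u

    projection-independent : ∀ c i → Independent H (Projection c i)
    projection-independent c i (x , fx≡c , refl) (y , fy≡c , refl) adjacent =
      proper x y (i , adjacent) (trans fx≡c (sym fy≡c))

    colour : Fin (N ^ t) → Fin m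
    colour w = f (decode ∘ finToFun w)

    class⊆box : ∀ c {w} → colour w ≡ c → ∀ i → Projection c i (decode (finToFun w i))
    class⊆box c {w} colour≡c i = decode ∘ finToFun w , colour≡c , refl

≗-from-halves : ∀ {a b} {A : Set} {g h : Fin (a + b) → A} →
                (∀ p → g (p ↑ˡ b) ≡ h (p ↑ˡ b)) → (∀ q → g (a ↑ʳ q) ≡ h (a ↑ʳ q)) → g ≗ h
≗-from-halves {a} {b} left right i with splitAt a i | join-splitAt a b i
... | inj₁ p | refl = left p
... | inj₂ q | refl = right q

all0? : ∀ {k} (w : Q k) → Dec (All0 w)
all0? w = all? λ i → w i ≟ᵇ false

all1? : ∀ {k} (w : Q k) → Dec (All1 w)
all1? w = all? λ i → w i ≟ᵇ true

true≢false : true ≢ false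
true≢false ()

¬All1-pre4 : ∀ {w} → w zero ≡ false → ¬ All1 (pre4 w)
¬All1-pre4 w₀≡false pre₁ = true≢false (trans (sym (pre₁ zero)) w₀≡false)

¬InS⇒uniform : ∀ {w} → ¬ InS w → w zero ≡ false →
               All0 (pre4 w) × (All0 (suf3 w) ⊎ All1 (suf3 w))
¬InS⇒uniform {w} ¬S w₀≡false with all0? (pre4 w) | all0? (suf3 w) | all1? (suf3 w)
... | no ¬pre₀ | _        | _        =
  contradiction (¬All1-pre4 {w} w₀≡false ∘ proj₁ , ¬pre₀ ∘ proj₁ , ¬pre₀ ∘ proj₁) ¬S
... | yes pre₀ | yes suf₀ | _        = pre₀ , inj₁ suf₀
... | yes pre₀ | no _     | yes suf₁ = pre₀ , inj₂ suf₁
... | yes _    | no ¬suf₀ | no ¬suf₁ =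
  contradiction (¬All1-pre4 {w} w₀≡false ∘ proj₁ , ¬suf₀ ∘ proj₂ , ¬suf₁ ∘ proj₂) ¬S

¬InS⇒¬All1-suffix : ∀ {w} → ¬ InS w → w zero ≡ true → ¬ All1 (suf3 w)
¬InS⇒¬All1-suffix {w} ¬S w₀≡true suf₁ =
  ¬S ((λ (_ , _ , ¬suf₁) → ¬suf₁ suf₁) , ¬pre₀ , ¬pre₀)
  where
  ¬pre₀ : ∀ {A : Set} → ¬ (All0 (pre4 w) × A)
  ¬pre₀ (pre₀ , _) = true≢false (trans (sym w₀≡true) (pre₀ zero))

module _ {n : ℕ} {u v : V (G n)} where

  ρ-agree : ∀ {i} → u i ≡ v i → ρ u v i ≡ false
  ρ-agree {i} eq with u i ≟ v i
  ... | yes _  = refl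
  ... | no neq = contradiction eq neq

  ρ-disagree : ∀ {i} → u i ≢ v i → ρ u v i ≡ true
  ρ-disagree {i} neq with u i ≟ v i
  ... | yes eq = contradiction eq neq
  ... | no _   = refl

  ρ-false⇒agree : ∀ {i} → ρ u v i ≡ false → u i ≡ v i
  ρ-false⇒agree {i} ρ≡false with u i ≟ v i
  ... | yes eq  = eq
  ... | no  _   = contradiction ρ≡false true≢false

  ρ-true⇒disagree : ∀ {i} → ρ u v i ≡ true → u i ≢ v i
  ρ-true⇒disagree ρ≡true eq = true≢false (trans (sym ρ≡true) (ρ-agree eq))

  nonadjacent-agree₀⇒≗ : ∀ {q} → ¬ Adj (G n) u v →
                          u zero ≡ v zero → u (4 ↑ʳ q) ≡ v (4 ↑ʳ q) → u ≗ v
  nonadjacent-agree₀⇒≗ {q} ¬adj u₀≡v₀ uq≡vq with ¬InS⇒uniform {ρ u v} ¬adj (ρ-agree u₀≡v₀)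
  ... | _    , inj₂ suf₁ = contradiction uq≡vq (ρ-true⇒disagree (suf₁ q))
  ... | pre₀ , inj₁ suf₀ = ≗-from-halves (ρ-false⇒agree ∘ pre₀) (ρ-false⇒agree ∘ suf₀)

  nonadjacent-disagree₀⇒agree-somewhere : ¬ Adj (G n) u v → u zero ≢ v zero →
                                          ¬ (∀ q → u (4 ↑ʳ q) ≢ v (4 ↑ʳ q))
  nonadjacent-disagree₀⇒agree-somewhere ¬adj u₀≢v₀ disagreement =
    ¬InS⇒¬All1-suffix {ρ u v} ¬adj (ρ-disagree u₀≢v₀) (ρ-disagree ∘ disagreement)

module _ {n : ℕ} {P : Pred (V (G n)) 0ℓ} (independent : Independent (G n) P) where

  label-single-group : (∀ {u v} → P u → P v → u zero ≡ v zero) →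
                       Σ (V (G n) → Fin (n * 3)) (InjectiveOn _≗_ P)
  label-single-group same₀ =
    (λ u → combine (u (4 ↑ʳ zero)) zero) ,
    λ Pu Pv eq → nonadjacent-agree₀⇒≗ (independent Pu Pv) (same₀ Pu Pv)
                   (proj₁ (combine-injective _ _ _ _ eq))

  module TwoGroups (a b : V (G n)) (Pa : P a) (Pb : P b) (a₀≢b₀ : a zero ≢ b zero) where

    opposite : Fin n → V (G n)
    opposite x with x ≟ a zero
    ... | yes _ = b
    ... | no  _ = a

    opposite-∈ : ∀ x → P (opposite x)
    opposite-∈ x with x ≟ a zero
    ... | yes _ = Pb
    ... | no  _ = Pa

    opposite-disagree₀ : ∀ x → x ≢ opposite x zero
    opposite-disagree₀ x with x ≟ a zero
    ... | yes x≡a₀ = λ x≡b₀ → a₀≢b₀ (trans (sym x≡a₀) x≡b₀)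
    ... | no  x≢a₀ = x≢a₀

    meeting : V (G n) → Fin 3
    meeting u with any? (λ q → u (4 ↑ʳ q) ≟ opposite (u zero) (4 ↑ʳ q))
    ... | yes (q , _) = q
    ... | no  _       = zero

    meeting-agrees : ∀ {u} → P u → u (4 ↑ʳ meeting u) ≡ opposite (u zero) (4 ↑ʳ meeting u)
    meeting-agrees {u} Pu with any? (λ q → u (4 ↑ʳ q) ≟ opposite (u zero) (4 ↑ʳ q))
    ... | yes (_ , agrees) = agrees
    ... | no  ¬agrees      =
      contradiction (λ q → ¬agrees ∘ (q ,_))
        (nonadjacent-disagree₀⇒agree-somewhere {u = u} {opposite (u zero)}
          (independent Pu (opposite-∈ (u zero))) (opposite-disagree₀ (u zero)))

    label : V (G n) → Fin (n * 3)
    label u = combine (u zero) (meeting u)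

    label-injective : InjectiveOn _≗_ P label
    label-injective {u} {v} Pu Pv eq
      with combine-injective (u zero) (meeting u) (v zero) (meeting v) eq
    ... | u₀≡v₀ , same-meeting =
      nonadjacent-agree₀⇒≗ (independent Pu Pv) u₀≡v₀ (begin
        u (4 ↑ʳ q)                 ≡⟨ meeting-agrees Pu ⟩
        opposite (u zero) (4 ↑ʳ q) ≡⟨ cong (λ x → opposite x (4 ↑ʳ q)) u₀≡v₀ ⟩
        opposite (v zero) (4 ↑ʳ q) ≡⟨ subst (λ r → v (4 ↑ʳ r) ≡ opposite (v zero) (4 ↑ʳ r))
                                             (sym same-meeting) (meeting-agrees Pv) ⟨
        v (4 ↑ʳ q)                 ∎)
      where
      q = meeting u
      open ≡-Reasoning

  G-independent-small : ¬ ¬ AtMost (n * 3) (P ∘ finToFun {n} {7})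
  G-independent-small =
    ¬¬-map ((λ (label , injective) → AtMost-finToFun label injective) ∘ label-by-cases)
           ¬¬-excluded-middle
    where
    label-by-cases : Dec (∃ λ a → ∃ λ b → P a × P b × a zero ≢ b zero) →
                     Σ (V (G n) → Fin (n * 3)) (InjectiveOn _≗_ P)
    label-by-cases (yes (a , b , Pa , Pb , a₀≢b₀)) =
      TwoGroups.label a b Pa Pb a₀≢b₀ , TwoGroups.label-injective a b Pa Pb a₀≢b₀
    label-by-cases (no ¬split) =
      label-single-group λ {u} {v} Pu Pv →
        decidable-stable (u zero ≟ v zero) λ u₀≢v₀ → ¬split (u , v , Pu , Pv , u₀≢v₀)

^-distribʳ-* : ∀ a b t → (a * b) ^ t ≡ a ^ t * b ^ t
^-distribʳ-* a b zero    = refl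
^-distribʳ-* a b (suc t) = begin
  a * b * (a * b) ^ t       ≡⟨ cong (a * b *_) (^-distribʳ-* a b t) ⟩
  a * b * (a ^ t * b ^ t)   ≡⟨ solve 4 (λ a b x y → a :* b :* (x :* y) := a :* x :* (b :* y))
                                       refl a b (a ^ t) (b ^ t) ⟩
  a * a ^ t * (b * b ^ t)   ∎
  where
  open ≡-Reasoning
  open +-*-Solver

cancel-n^t : ∀ t n m → (n ^ 7) ^ t ≤ m * (n * 3) ^ t → n ^ (6 * t) ≤ 3 ^ t * m
cancel-n^t zero    zero m 1≤m*1 = subst (1 ≤_) (*-comm m 1) 1≤m*1
cancel-n^t (suc t) zero m _     = z≤n
cancel-n^t t n@(suc _) m bound  = *-cancelˡ-≤ (n ^ t) {{m^n≢0 n t}} (subst₂ _≤_ lhs rhs bound)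
  where
  open ≡-Reasoning
  open +-*-Solver
  lhs : (n ^ 7) ^ t ≡ n ^ t * n ^ (6 * t)
  lhs = trans (^-*-assoc n 7 t) (^-distribˡ-+-* n t (6 * t))
  rhs : m * (n * 3) ^ t ≡ n ^ t * (3 ^ t * m)
  rhs = begin
    m * (n * 3) ^ t        ≡⟨ cong (m *_) (^-distribʳ-* n 3 t) ⟩
    m * (n ^ t * 3 ^ t)    ≡⟨ solve 3 (λ m x y → m :* (x :* y) := x :* (y :* m))
                                      refl m (n ^ t) (3 ^ t) ⟩
    n ^ t * (3 ^ t * m)    ∎

corollary3p4 : (t : ℕ) → 1 ≤ t →
    Σ ℕ (λ C → 1 ≤ C ×
    ((n m : ℕ) (f : V (ORPower t (G n)) → Fin m) →
    ProperColoring (ORPower t (G n)) m f → n ^ (6 * t) ≤ C * m))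
corollary3p4 t _ = 3 ^ t , m^n>0 3 t , λ n m f proper →
  cancel-n^t t n m (orPower-colouring-bound (G n) finToFun G-independent-small t m f proper)
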